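{- Let $L = \mathbb{Q}(\alpha)$ where $\alpha$ is a root of $z^9 - 2z^8 - 6z^7 + 8z^6 - 7z^5 + 18z^4 + 44z^3 + 32z^2 + 24z + 24$. Then there exist polynomials $A, B, Q, X, Y \in L[t]$ with $\deg A = 1$, $\deg B = 2$, $\deg Q = 2$, $\deg X = 8$, $\deg Y = 11$ such that $$X(t)^3 + A(t)X(t) + B(t) = Q(t)\,Y(t)^2$$ and $4A(t)^3 + 27B(t)^2$ is not the zero polynomial. -}

module Defs where

open import Data.Nat using (ℕ; zero; suc; _<_)
open import Data.Integer using (+_)
open import Data.Rational using (ℚ; 0ℚ; 1ℚ; _/_; -_) renaming (_+_ to _+ℚ_; _*_ to _*ℚ_)
open import Data.Vec using (Vec; []; _∷_; zipWith; replicate; foldr)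
import Data.Vec as V
open import Data.List using (List; []; _∷_)
open import Relation.Binary.PropositionalEquality using (_≡_; _≢_)
open import Data.Product using (_×_)

-- The number field L = ℚ(α) = ℚ[z]/(f), where
--   f = z^9 - 2z^8 - 6z^7 + 8z^6 - 7z^5 + 18z^4 + 44z^3 + 32z^2 + 24z + 24.
-- An element of L is represented canonically by its coordinates
-- (c₀, …, c₈) in the power basis 1, α, …, α⁸ (lowest degree first).
-- Since ℚ (Data.Rational) is normalised, ≡ on L is equality in L.

L : Set
L = Vec ℚ 9

int : ℕ → ℚ
int n = + n / 1

α⁹ : L
α⁹ = - int 24 ∷ - int 24 ∷ - int 32 ∷ - int 44 ∷ - int 18 ∷ int 7 ∷ - int 8 ∷ int 6 ∷ int 2 ∷ []

0L : L
0L = replicate 9 0ℚ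

1L : L
1L = 1ℚ ∷ replicate 8 0ℚ

α : L
α = 0ℚ ∷ 1ℚ ∷ replicate 7 0ℚ

_+L_ : L → L → L
_+L_ = zipWith _+ℚ_

-L_ : L → L
-L_ = V.map -_

_·L_ : ℚ → L → L
c ·L x = V.map (c *ℚ_) x

mulα : L → L
mulα (c₀ ∷ c₁ ∷ c₂ ∷ c₃ ∷ c₄ ∷ c₅ ∷ c₆ ∷ c₇ ∷ c₈ ∷ []) =
  (0ℚ ∷ c₀ ∷ c₁ ∷ c₂ ∷ c₃ ∷ c₄ ∷ c₅ ∷ c₆ ∷ c₇ ∷ []) +L (c₈ ·L α⁹)

_*L_ : L → L → L
a *L b = foldr (λ _ → L) (λ aᵢ acc → (aᵢ ·L b) +L mulα acc) 0L a

-- Polynomials in L[t], as coefficient lists (lowest degree first).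
-- Trailing zero coefficients are allowed; all notions below are
-- insensitive to them.

Poly : Set
Poly = List L

_+P_ : Poly → Poly → Poly
[] +P q = q
(a ∷ p) +P [] = a ∷ p
(a ∷ p) +P (b ∷ q) = (a +L b) ∷ (p +P q)

scaleP : L → Poly → Poly
scaleP c [] = []
scaleP c (a ∷ p) = (c *L a) ∷ scaleP c p

_*P_ : Poly → Poly → Poly
[] *P q = []
(a ∷ p) *P q = scaleP a q +P (0L ∷ (p *P q))

-P_ : Poly → Poly
-P_ = Data.List.map -L_

constP : L → Poly
constP c = c ∷ []

coeff : Poly → ℕ → L
coeff [] k = 0L
coeff (a ∷ p) zero = a
coeff (a ∷ p) (suc k) = coeff p k

IsZeroPoly : Poly → Set
IsZeroPoly p = ∀ k → coeff p k ≡ 0L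

HasDegree : Poly → ℕ → Set
HasDegree p d = (coeff p d ≢ 0L) × (∀ k → d < k → coeff p k ≡ 0L)

{-# OPTIONS --safe #-}
module Submission where

-- Elements of L = ℚ[z]/(f) are normalised
-- coordinate vectors in the power basis, so equality in L is decidable and
-- every claim is settled by exact evaluation of the arithmetic of L[t].

open import Data.Integer using (+_; -[1+_])
open import Data.List using ([]; _∷_; length)
open import Data.List.Relation.Unary.All using (All; []; _∷_; all?)
open import Data.Nat using (ℕ; zero; suc; _≤_; s≤s)
open import Data.Product using (Σ; _×_; _,_)
open import Data.Rational using (0ℚ; _/_)
import Data.Rational.Properties as ℚ
open import Data.Vec using ([]; _∷_)
open import Data.Vec.Properties using (≡-dec)
open import Relation.Binary.PropositionalEquality using (_≡_; _≢_; refl; sym; subst)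
open import Relation.Nullary using (¬_; Dec)
open import Relation.Nullary.Decidable using (True; False; toWitness; toWitnessFalse)

open import Defs

_≟0L : (x : L) → Dec (x ≡ 0L)
x ≟0L = ≡-dec ℚ._≟_ x 0L

All-zero⇒IsZeroPoly : ∀ {p} → All (_≡ 0L) p → IsZeroPoly p
All-zero⇒IsZeroPoly []         _       = refl
All-zero⇒IsZeroPoly (a≡0 ∷ _)  zero    = a≡0
All-zero⇒IsZeroPoly (_ ∷ p≡0)  (suc k) = All-zero⇒IsZeroPoly p≡0 k

coeff-≥-length : ∀ p {k} → length p ≤ k → coeff p k ≡ 0L
coeff-≥-length []      _         = refl
coeff-≥-length (_ ∷ p) (s≤s p≤k) = coeff-≥-length p p≤k

HasDegree-lastCoeff : ∀ p {d} → length p ≡ suc d → coeff p d ≢ 0L → HasDegree p d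
HasDegree-lastCoeff p |p|≡1+d pd≢0 =
  pd≢0 , λ k d<k → coeff-≥-length p (subst (_≤ k) (sym |p|≡1+d) d<k)

IsZeroPoly-by-evaluation : (p : Poly) → {True (all? _≟0L p)} → IsZeroPoly p
IsZeroPoly-by-evaluation p {p≡0} = All-zero⇒IsZeroPoly (toWitness p≡0)

HasDegree-by-evaluation : (p : Poly) (d : ℕ) → length p ≡ suc d →
                          {False (coeff p d ≟0L)} → HasDegree p d
HasDegree-by-evaluation p d |p|≡1+d {pd≢0} = HasDegree-lastCoeff p |p|≡1+d (toWitnessFalse pd≢0)

¬IsZeroPoly-by-evaluation : (p : Poly) (k : ℕ) → {False (coeff p k ≟0L)} → ¬ IsZeroPoly p
¬IsZeroPoly-by-evaluation p k {pk≢0} p≡0 = toWitnessFalse pk≢0 (p≡0 k)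

weierstrassResidual : (A B Q X Y : Poly) → Poly
weierstrassResidual A B Q X Y = (((X *P (X *P X)) +P (A *P X)) +P B) +P (-P (Q *P (Y *P Y)))

discriminant : (A B : Poly) → Poly
discriminant A B = (constP (int 4 ·L 1L) *P (A *P (A *P A))) +P (constP (int 27 ·L 1L) *P (B *P B))

A₀ : Poly
A₀ =
    ( (((+ 1561063697705337918511022807892270160744502946137772316298625061060401598653802383006481835938109797407033087411281681308146929084118269952) / 275) ∷ ((+ 67546454523146122368864467824057969211903071375187407778503640130269614467873275364235215539928135576246117564078408835446800686510964736) / 275) ∷ ((+ 1810163950045218708537380766570705907149780481537186306060880983114560038226970364999855975754553677232472564888954944178638136644556341248) / 275) ∷ ((+ 1920902188294050658818459627671331015220132072124642553977594548866977700760138898751183486620299845838145489078321712992165673887414550528) / 275) ∷ (-[1+ 213537992497586425173878204029656969158878373720662473754240554019244493298797461713275562414869303443189520034440605261264890042242220031 ] / 55) ∷ ((+ 1316683667111675145259159682420215637435158217857559620609151387657590737858055844658298530338457334337355044523163975949199011532883820544) / 275) ∷ (-[1+ 448554469559925043599506985138873322791263085048813934995705675846927098051057680373355585549310886166091073514633795957191082453202157567 ] / 275) ∷ (-[1+ 275280643366864747761189754596763521399763073124930452417130894876928559490758428312349731137679834545200402788878154710672652287903596543 ] / 275) ∷ ((+ 97482396520642463697234184056864050282011677980870198948485096247020963683383657029303752004708223075724190190311166766784784244402733056) / 275) ∷ [])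
    ∷ ((-[1+ 20541619897727501116205409542871297871978682190492256577478343077321395756738420672211687955138111202057444540928688526256135346843287551 ] / 11) ∷ ((+ 33601205322054127630002486794381153828387029691731434130626337421711044211453658253916446322309503591601774946273789077923171190677438464) / 11) ∷ (-[1+ 41815261096724480965722828645249191383232780284358758616646861506289155873656819041119565599307267033782637442717306514682811868873883647 ] / 11) ∷ ((+ 3640604623629377392153020324428779731479273646016554375343650959410288777531161009839880839808437483073542391700101221336249099234967552) / 1) ∷ (-[1+ 4952831981356361554704912203920773542133962594007775595597309744829131772340797122884472299853195417909500837864178678728431364272291839 ] / 11) ∷ ((+ 848879002621638011396131119347234429310724170185980332901341690088729412728563038905381551153974987711987965967019920157724944655712256) / 11) ∷ (-[1+ 572945178899145994365491695009001830255080208106933374451645270983880710786043240853469521962159348479523829432310749000697030106284031 ] / 11) ∷ (-[1+ 1438591363336952613297157789741398735697966460126370151273923270203281988829436591539725397866434472007006020414999931853190384887136255 ] / 11) ∷ ((+ 463137924359871730925396881359214553847109467030581006973052837228192073321874809170384271516738138230951378763802678980832306594054144) / 11) ∷ [])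
    ∷ [])

B₀ : Poly
B₀ =
    ( (((+ 510110375430932459694612867092144648990624576356682470172225862692424186539253362344979993922128849182486447446830996553329895958921800654214601345766243091872053116182721892705877336696523100831637238185984) / 1375) ∷ (-[1+ 8802805391326595565289875594648972134469568004505347171439127243990493248132508364565205726227630217916246624748175918071277538981387414294794279321295075178302551702874094038367799379134233085532866347007 ] / 125) ∷ ((+ 877415504061523681856040326613000214541731108166873480069295301701318100745636407162714346872173392012265663194956713231240135278756483543106664015604848179107924754756359086648404690720142147318072964284416) / 1375) ∷ ((+ 72333179837868877981059323290207735053701998975939447731208461323878815116985375388184739316165423511835484606552014209673276694583746055868162669229479698726152597098628939449151875304281459291216911794176) / 1375) ∷ ((+ 30483853353066276291064725224989964890581744795479558325786473953520409641227467235018571946089578936552830238553950968865853512305545993630359567097128345261607646051499477446421959947914181429523073990656) / 275) ∷ ((+ 39149695837107993717510995934684932375265190787966588070959636995344261207999327891517022067632590041982760086168329155691604299268741104038715858857880220508412851855316588498385642497742402406393837518848) / 1375) ∷ (-[1+ 118649842693668922853255686115566851004645782471515340192522001857025655164435378221345197386818515212892523791149302055580540132350006275001945128234292164190346337953641553988388746009636251268766400249855 ] / 1375) ∷ (-[1+ 7640795738051196245560667869360369101855090619700048011256328735964363298527450351565453601191431804372942444047395781310297190668474437688600652651681410813249083271986292798389373212816614972275292110847 ] / 1375) ∷ ((+ 11284066798282323433576456968134328806028786723143978611786861569042782546156591851324713754727433345364653813536928356767678096607344319239451029493341339945127674228224189690442596475119282738995084132352) / 1375) ∷ [])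
    ∷ (((+ 24171668503774411770622449568238067385516318788284677948703450750823383601538481732567685009634535064506141983905179031050130507087637525795863046891972789213971453672172655823393496223364450808447188860928) / 121) ∷ ((+ 16467389842872577824210115286668632696621037753405319082579452628886648961202772220702837143891230461915616652251366724442431588152848220882659797339437236089897056510351146985240302596593439940110769455104) / 121) ∷ ((+ 13159595313237958854745786436336852681505408395232335837719267033448656174990366127807718918907327116027166980934507581872324444982096818100873102002149663027064614440572344798597689831063326812802616655872) / 121) ∷ ((+ 45700783173859897471413759817772677190008773906485425279091500299739498984631761982202417304426362001488646486473424647641497322714374927937815225527287132873051514979439878720069542572933573980762555809792) / 121) ∷ (-[1+ 22129346861142544542178604649983447925350485761581667671007585051903843136284675662487029308961632497316880491530434931155842369435486890428330310911014421037583935532892948624794270996859339108329445130239 ] / 121) ∷ ((+ 5779557072804218666267028724628679931538517444307204321775698484266112349202666335365068233520074633230168892790678033444398576075155948647387117515123151016490240409872461845474340672175341466304502562816) / 121) ∷ (-[1+ 1374234939396535548867292854401985272387246472461794364386314569561148799567251222965480354761668551021932192840006357970010912319359246796871432571710857079582618636723111544078810759086261217024490340351 ] / 121) ∷ (-[1+ 2335315090908413992680458924858116068864813788034728099065033578608063134632029099475675391195444333074558341474497989739283684123353863793817572320554200580404278445939409045400437682828862709437160226815 ] / 121) ∷ ((+ 794058297121504660545972325387622884588727554892053921133304366209759505351332338666447771229783404302696458308217105596131942523474955836345200799803941534440081448827857792523362173683021265695968067584) / 121) ∷ [])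
    ∷ ((-[1+ 65549283877793216316892707718564304175566133105060235012194489274467688633210841659618362389891009147102707393248265893326428431657203417457500101413319225507398067614225757463765454795506025165775605596159 ] / 1331) ∷ ((+ 40130467630892479530698180718763564413756575354554511798847218794307479907903499090241430256947306327137782110550163259052711530623433028780529633114673196183741677784130605217682690247780196471765330821120) / 1331) ∷ (-[1+ 123598898058560309956352109787806345795878552944366293775014404296291788722211313494940869063463470199757056207972180403983789970498392559670133176198507021481125412501355619117587211194810528302284763299839 ] / 1331) ∷ ((+ 30476924948367506972683873843991359649113743699816671083887348695431535021811594167505198922535779868938926583559039694445951893560741599712595837701337135362744130975708865122005444748711176905074419957760) / 1331) ∷ (-[1+ 22738204131426386502804641431541273861580499438067214192405608165707849447888669663726166515904844639369934856142885671037898606585671357791274061570150198655775792099345615656281347150392605595923591987199 ] / 1331) ∷ (-[1+ 6057834191240775202179048195988553124883505232561953342532517830445937685001532631508500974971851098530222137204145484746467903907316585831125097093734671600485154742142803917299880220449025380801073643519 ] / 1331) ∷ ((+ 12854754198016808559793149903503922057397337295786261110352706326014450035140473251806358851383990681078676369672922344675884544536326057530125578216780885946359735633084591767604926708905224918487468605440) / 1331) ∷ (-[1+ 92068183777427209320554200055756472240903913872035774562296007581407213901514186955651936959791078836018452960968201694945704939916632112417742427914662174378681589737674275677892687584497090125344276479 ] / 1331) ∷ (-[1+ 892888715121122351017551957632524146108439826699052326104073896451024908412633140202764250209133580651958905414799622465009132448703027250802371888648400733893752962266588766321968162657177282521050644479 ] / 1331) ∷ [])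
    ∷ [])

Q₀ : Poly
Q₀ =
    ( (((+ 73243542225413486001) / 166375) ∷ ((+ 9424171977368879568) / 166375) ∷ ((+ 70415370722247305224) / 166375) ∷ ((+ 69748246931483670864) / 166375) ∷ (-[1+ 6011095982034289415 ] / 33275) ∷ ((+ 30807657109788289072) / 166375) ∷ (-[1+ 12480785780304237383 ] / 166375) ∷ (-[1+ 7104482259183957071 ] / 166375) ∷ ((+ 2639113519092432728) / 166375) ∷ [])
    ∷ (((+ 32448542070414780) / 121) ∷ 0ℚ ∷ 0ℚ ∷ 0ℚ ∷ 0ℚ ∷ 0ℚ ∷ 0ℚ ∷ 0ℚ ∷ 0ℚ ∷ [])
    ∷ (((+ 32448542070414780) / 121) ∷ 0ℚ ∷ 0ℚ ∷ 0ℚ ∷ 0ℚ ∷ 0ℚ ∷ 0ℚ ∷ 0ℚ ∷ 0ℚ ∷ [])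
    ∷ [])

X₀ : Poly
X₀ =
    ( (((+ 23401751680583420807203386287147996828980856630624575324636483938591) / 1) ∷ ((+ 6461335005527994624964384391400084438531955500778955943405051650688) / 1) ∷ ((+ 8259769176453782024079734994928437490451978709568667127566508195384) / 1) ∷ ((+ 45410857332987635203777798398623072357133913667717820776129844101124) / 1) ∷ (-[1+ 38050875951741432472534518959647064029797052094688490630192220163029 ] / 1) ∷ ((+ 21739250090166030703803241362516435684610421317874298350224255725552) / 1) ∷ (-[1+ 1576072286940843936368860560481976583606204295204909077698216124443 ] / 1) ∷ (-[1+ 4968636164387568794388575758004698618064290298594171449718077796051 ] / 1) ∷ ((+ 1311827989141382897387290279724152075573808965727355199175474139498) / 1) ∷ [])
    ∷ ((-[1+ 46828408485804278652198865201570378237305816436783170006756749883359 ] / 1) ∷ (-[1+ 692200548340882250931917998046200605737517625783813952514247008479 ] / 1) ∷ (-[1+ 53671286704750493918686041644283078986199435267744423174703207832639 ] / 1) ∷ (-[1+ 37875131777792800172117811890202469790475087806559566784375964883039 ] / 1) ∷ ((+ 20483797858570583147038030347655824071927582419915245763894476013800) / 1) ∷ (-[1+ 13808358441514489661286040730726922491449611285201526820626839721919 ] / 1) ∷ ((+ 6094198696077130883350113607201944697117329942478354114435809240240) / 1) ∷ ((+ 3370458081287496191639620755624570726421112030505970952408720401920) / 1) ∷ (-[1+ 1340018971787860158058636008581704596389458163795643034032864901079 ] / 1) ∷ [])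
    ∷ (((+ 68202371862223767558440630824586079333096193067097230954959793166000) / 1) ∷ ((+ 4106772063188718028746343571174361346301427663108186463668999288000) / 1) ∷ ((+ 67206640739483069843346659874838481345243830193316114515932132684000) / 1) ∷ ((+ 78135442446209340599278045636210963670443652128461248746862872674000) / 1) ∷ (-[1+ 51752039782442881008456364947667655178429580220612811417713538404999 ] / 1) ∷ ((+ 39940645023222183175792232380983103090618314681934997205949404952000) / 1) ∷ (-[1+ 10470233575777664124580507620422753174437951317909776844480599993999 ] / 1) ∷ (-[1+ 8893661671923965733968516792207721344340256483038708084088919201999 ] / 1) ∷ ((+ 2918422393483959898653589147708466639846263212782013931876835723000) / 1) ∷ [])
    ∷ ((-[1+ 25811612342998284847890289719807643684608220810059889911598773599999 ] / 1) ∷ (-[1+ 1187063834440561420268869536921765074130649278959918278588504799999 ] / 1) ∷ (-[1+ 29252475234482065449030260417747953170943952613538443577804886399999 ] / 1) ∷ (-[1+ 21884021397218690053622898757729903974235890706531262493949490399999 ] / 1) ∷ ((+ 11718292337090830616321985732046757298724928676461529827213463000000) / 1) ∷ (-[1+ 7546868411078485283826148940582196337458574443989001404072899199999 ] / 1) ∷ ((+ 3212341435270175408866604995004978030340182075233837899808112400000) / 1) ∷ ((+ 1874411239495032895173128049053857167772304303996742863224699200000) / 1) ∷ (-[1+ 730089155726226521387174560991863134031277741098947259212205799999 ] / 1) ∷ [])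
    ∷ (((+ 26500251150612271306247062522565478524771249810274713830732732500000) / 1) ∷ (-[1+ 1108160860347081202385543180326382157444560614508323060150439999999 ] / 1) ∷ ((+ 27189294917738494090792725815827984175078886772145355698658330000000) / 1) ∷ ((+ 27793508725205056948396581836169217200682887133860282022897755000000) / 1) ∷ (-[1+ 20694143121937405240589330045378853781687670580195831644185162499999 ] / 1) ∷ ((+ 17714040065266642259565489168180141053540121960134179580896740000000) / 1) ∷ (-[1+ 4143462417946078599986530423244805116226050906070911183419904999999 ] / 1) ∷ (-[1+ 3725797726628030971419138082054404770342228195478366374403614999999 ] / 1) ∷ ((+ 1164506852407699800475200166912342024411873441221713962070197500000) / 1) ∷ [])
    ∷ ((-[1+ 9846085038473864732640879334310453899081748296555593391790999999999 ] / 1) ∷ ((+ 3652527349293010009135223991231772611277107185557126247337000000000) / 1) ∷ (-[1+ 12772848090458788429294875512298018394969587608120256755933999999999 ] / 1) ∷ (-[1+ 3007463397780008630847649368091887266377998869181548350298999999999 ] / 1) ∷ ((+ 3159771901393900537195112951407747743117337497049524947936250000000) / 1) ∷ (-[1+ 2434922223119275421486712178756836381997420925608860287201999999999 ] / 1) ∷ ((+ 909274205873524438985645353283382839279124450604724870431500000000) / 1) ∷ ((+ 467034995956993246621583876064232014327580899824870551452000000000) / 1) ∷ (-[1+ 179180247007804079629888008327124029334366421778521083941749999999 ] / 1) ∷ [])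
    ∷ (((+ 6370306008789824063691653104552520841455096497374206064937500000000) / 1) ∷ (-[1+ 1279239714090602150586125069550113313660827250994589834249999999999 ] / 1) ∷ ((+ 7447236101196786092620616604821696969800884321674143811625000000000) / 1) ∷ ((+ 6510956554215976176965982160200046415055311419074819066937500000000) / 1) ∷ (-[1+ 3958357631193169339933237076019002175238292248399877081718749999999 ] / 1) ∷ ((+ 4046521560661687371817108642241215746500235831883542644250000000000) / 1) ∷ (-[1+ 1105740935457529523287507175119793489009631374110575209437499999999 ] / 1) ∷ (-[1+ 841215513516872454593167051486828461609127511063560511437499999999 ] / 1) ∷ ((+ 267118188342938872746921203706155527831023546383954887781250000000) / 1) ∷ [])
    ∷ (0ℚ ∷ 0ℚ ∷ 0ℚ ∷ 0ℚ ∷ 0ℚ ∷ 0ℚ ∷ 0ℚ ∷ 0ℚ ∷ 0ℚ ∷ [])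
    ∷ (((+ 2239566133433874607729482833398114205349022383345071648437500000000) / 1) ∷ 0ℚ ∷ 0ℚ ∷ 0ℚ ∷ 0ℚ ∷ 0ℚ ∷ 0ℚ ∷ 0ℚ ∷ 0ℚ ∷ [])
    ∷ [])

Y₀ : Poly
Y₀ =
    ( ((-[1+ 7761130012035203081008623208442069687765069346643558569742776163100888414630750422993556015618 ] / 1) ∷ (-[1+ 236476191912472680390505676834758294677883369417851947936012285429124445095687221137912325591 ] / 1) ∷ (-[1+ 9336477828364824055107702034980282684933170238798891493186697663540402262351651776033371732655 ] / 1) ∷ (-[1+ 6447039829332953371919958242711395963565960474535622161342450023626987415471813274686618190065 ] / 1) ∷ ((+ 2966891134518141415306342286406799465226536388730857573450654397793855043866158790690603140645) / 1) ∷ (-[1+ 2571692072520114777197488909566292095285652247588135608554879008109664870757765229234630422567 ] / 1) ∷ ((+ 1279822899881703852316558952293844170678919204800318675211576226162660098961977011512515653446) / 1) ∷ ((+ 611522001092164739764004356474291019989096165292411625842573363359487078934398626415010550818) / 1) ∷ (-[1+ 253519960845026271943566524098669381439853297278454800194944313738164288106785931205039568506 ] / 1) ∷ [])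
    ∷ (((+ 29057967916133206731332052508133721760979141131539875200023797777001561890003685614555015856150) / 1) ∷ ((+ 6324352762402596699199754020076966596278247901944896985838855399415988651215491003902890943200) / 1) ∷ ((+ 23153251396196909419180167716744178595152598007244436021128660544843141455519798261646499427600) / 1) ∷ ((+ 40704003898313470261971604636719893383595528278539866661481606043591240694028035151180926926100) / 1) ∷ (-[1+ 26677530878350346310898267884067955199340937701505052521281085793612778455693804078978996885749 ] / 1) ∷ ((+ 15860652265410412185308749982494074486092689640588235656484825505674246000527386975965079942800) / 1) ∷ (-[1+ 3394188814715202579083717658059741376825156647089878989426486371611285819174140582167283024099 ] / 1) ∷ (-[1+ 3838205985973032645712736862669864081777997499961360736230097723324023471025381127384603955299 ] / 1) ∷ ((+ 1217640918262910891693469411166683524949872163415421501009325815784657593923534151295633033450) / 1) ∷ [])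
    ∷ ((-[1+ 32576956993796887119937047589873152585341822769364036373016922128159491369230582843955801092499 ] / 1) ∷ (-[1+ 5103576207122083035881644061661849820990983190890833146189578581331805128656898219736313039999 ] / 1) ∷ (-[1+ 34735373917134606275292080887619276458471567876116703064376109408460242400876733996330587219999 ] / 1) ∷ (-[1+ 35161750408456568722556117211092961887772639638371285656359362737192840462850898700247855169999 ] / 1) ∷ ((+ 17031896075110314105857050305695007991969449001388979018971125317925139305385043666589959900000) / 1) ∷ (-[1+ 11999615755933911353229411788967571727131349829963844939800296144163255000643283004750813659999 ] / 1) ∷ ((+ 5008932350525305702366757958096444940235061920545367234568895859340255814460914702066747020000) / 1) ∷ ((+ 3017136325661189608118842974430611646878081696260006294557966270032217466876511756132734910000) / 1) ∷ (-[1+ 1157370427660156694394732904739687832688481051757730712592442773233532159361270602679190339999 ] / 1) ∷ [])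
    ∷ (((+ 31603830838070990564796274694719566561563667688180556030896061275093177991291735613429923625000) / 1) ∷ ((+ 3671913471179257880270831485157971465085636911525273016447113747688563544142152480277744000000) / 1) ∷ ((+ 26378179139892263601456844730793060194008954852360032031546348897607282403213102249906517000000) / 1) ∷ ((+ 39336666378312518824586055923336857355805700736113887096454602006275362649519160682841074500000) / 1) ∷ (-[1+ 28411153581533076491011253064630612444264129859675500195697688330653012683702438546391139999999 ] / 1) ∷ ((+ 16862463887431125595313098854517484129275747340576877493763920956269605355171639610659251000000) / 1) ∷ (-[1+ 3178759161333885659045732966838150684411351132339516325760028316898504464834502808390296999999 ] / 1) ∷ (-[1+ 3950213918440848097008206463897676119027767689286596816507887971537285162581474536852313499999 ] / 1) ∷ ((+ 1215359570116385756069089054918077044001639075284915482565718890694601400738027491044524000000) / 1) ∷ [])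
    ∷ ((-[1+ 29366505983372014456973895571037327789086930078510676526763371338965123392653028093450187499999 ] / 1) ∷ (-[1+ 996714708011916456478548829504534511911425832581646040111520515904900790320241445206499999999 ] / 1) ∷ (-[1+ 32847033138842762562303957327828806045257948411922707322026136416701490931503300652873249999999 ] / 1) ∷ (-[1+ 25107433541340010225282657796989105877223823582375568037598063356594435383588275338180749999999 ] / 1) ∷ ((+ 13809502657202775853125122328240762065285628380961429608303703411989645916563581082054062500000) / 1) ∷ (-[1+ 9022315041870644159636381605226616936784873175696017491236853352575314565782090154257249999999 ] / 1) ∷ ((+ 3688946867277699875491226260744472613761909203019814225280890456563010146976691711450125000000) / 1) ∷ ((+ 2212185069519405773125824087124715852143585391234676555134034318575705533902236665288500000000) / 1) ∷ (-[1+ 851181743805957963300507409509220444600728829695726831664183515485260715380591306509937499999 ] / 1) ∷ [])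
    ∷ (((+ 18937237494697066402517905992536266865560863418741793326287915015641866165759107845079375000000) / 1) ∷ (-[1+ 107361870892644717758576906540836708348141683442984937842255207360200711661103959289999999999 ] / 1) ∷ ((+ 19519258399477289129611970308996628434282655777967732601087566429337517556478238147467500000000) / 1) ∷ ((+ 18533888701380698599319960333989569939285805848540128039557668677784749130890132163892500000000) / 1) ∷ (-[1+ 12942982256896997349401315786310321025795033806521758434478616891123848597161465708459374999999 ] / 1) ∷ ((+ 9410132142413361689351891721115030185681657201855401368347108077265259454256657452902500000000) / 1) ∷ (-[1+ 2433171281362423796219472518190437310879460600860822869752860245776331039813646957198749999999 ] / 1) ∷ (-[1+ 2089300189467237571573302951308720475973925349748946883766924251019210277814034164464999999999 ] / 1) ∷ ((+ 685033299960835610187376298868404663215965004526937548625832553666049236403453045050625000000) / 1) ∷ [])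
    ∷ ((-[1+ 8259567316081788617536877993004004219774614236988645353506801176407850852696163196156249999999 ] / 1) ∷ ((+ 280465369527209358724685664433269140569575291665320989185415372553889837013438739500000000000) / 1) ∷ (-[1+ 9406296783657734795486962998199993614763134460884063274029159273631774307160470298374999999999 ] / 1) ∷ (-[1+ 6537639678199625679467192962226108941736221148010359095342901097431304717967598533687499999999 ] / 1) ∷ ((+ 4089019175186919829346407937811902718409477215053504933039277940813304327603751911250000000000) / 1) ∷ (-[1+ 2877050569964003618876808021583576861948312535326747262391465907355458610004944545124999999999 ] / 1) ∷ ((+ 995752864469671701588391389582125119836063838291503039866341025850627253937066808375000000000) / 1) ∷ ((+ 659516676996207183258768327006436561375092950325945368417525197864018291492302974812500000000) / 1) ∷ (-[1+ 238437247450532482309136970093313836587815212594739184976183969676983542321307051749999999999 ] / 1) ∷ [])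
    ∷ (((+ 4798008819029720225561630221539921151134501382218998183343373745236747419838470745312500000000) / 1) ∷ (-[1+ 471119055843236225780132473138664248118457820069924637515426750237078983294777599999999999999 ] / 1) ∷ ((+ 5059818530673036295791188467661583777792207435330736597791397274787675293829180543750000000000) / 1) ∷ ((+ 4524025815217235052160824434436214021844884716609336807003279246080687808104123559375000000000) / 1) ∷ (-[1+ 3491927504842889348575770933667081861454063909307549493492499910685128187182099468749999999999 ] / 1) ∷ ((+ 2905563089165425265875387295442390795223418979490968140792394643408660473399146006250000000000) / 1) ∷ (-[1+ 661466116299580601014228609241589234663304823415146922446271837374881449906998231249999999999 ] / 1) ∷ (-[1+ 607341568544933559158331887117711265745989680727264736424914815687482016555348740624999999999 ] / 1) ∷ ((+ 187981137033563312940482207356859729528985454846543574114164884489726336345679931250000000000) / 1) ∷ [])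
    ∷ ((-[1+ 1598271282696498085625523627824035675914290113624565538638491979634825274838749335937499999999 ] / 1) ∷ ((+ 620782256698879934772594475684640724520138767527795450662310517297971758169361562500000000000) / 1) ∷ (-[1+ 2019050922007195419370665444567751226177843696912791436392397594340373524208484062499999999999 ] / 1) ∷ (-[1+ 618553270940694123042100869711889231958707426422908702468487145823413771720119609374999999999 ] / 1) ∷ ((+ 601036186651055185801351864005179555638710874945068185711959447526427097505479101562500000000) / 1) ∷ (-[1+ 505130031938420468158857545347535946645794056803190554329562853450725505929444374999999999999 ] / 1) ∷ ((+ 157489677878664107540422719438255144735137704628405291616208850806492929407000859375000000000) / 1) ∷ ((+ 97234443574562221740902758061497165240295913688369875388302794626440752031895546875000000000) / 1) ∷ (-[1+ 33790227087367304511743605680466408193655847434991128051941531075859281765429648437499999999 ] / 1) ∷ [])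
    ∷ (((+ 781989196019191565084618355848651121974933429925598794580202429042874862309904296875000000000) / 1) ∷ (-[1+ 196970888302040485596836219685310651858377294533615622709820273092230888753656249999999999999 ] / 1) ∷ ((+ 859350520093058559961336462387376988068116036026078542790715341916336874910750000000000000000) / 1) ∷ ((+ 732537132643449659527408393636853426091562473281363042016958380886691652231433593750000000000) / 1) ∷ (-[1+ 473669904345107100406377072514624584346774407109970628651873538365796259336044921874999999999 ] / 1) ∷ ((+ 484030079178000283686352208233879768970429544449721999542425026662953397889281250000000000000) / 1) ∷ (-[1+ 122947318331710302862153841967709157630058498735259767452246974606608961767410156249999999999 ] / 1) ∷ (-[1+ 99017615938541307636594856650542790085657904779028857195873985333052922824339843749999999999 ] / 1) ∷ ((+ 30563066064817253405004638813002651108051832907493190733327536146205600486548828125000000000) / 1) ∷ [])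
    ∷ ((-[1+ 102331875195969463972540545881606755445484404534889788678043842884687557561035156249999999999 ] / 1) ∷ 0ℚ ∷ 0ℚ ∷ 0ℚ ∷ 0ℚ ∷ 0ℚ ∷ 0ℚ ∷ 0ℚ ∷ 0ℚ ∷ [])
    ∷ (((+ 204663750391938927945081091763213510890968809069779577356087685769375115122070312500000000000) / 1) ∷ 0ℚ ∷ 0ℚ ∷ 0ℚ ∷ 0ℚ ∷ 0ℚ ∷ 0ℚ ∷ 0ℚ ∷ 0ℚ ∷ [])
    ∷ [])


-- 4A₀³ has degree 3, so the coefficient of t⁴ is 27·lc(B₀)² ≠ 0.
discriminant≢0 : ¬ IsZeroPoly (discriminant A₀ B₀)
discriminant≢0 = ¬IsZeroPoly-by-evaluation (discriminant A₀ B₀) 4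

mainTheorem3 : Σ Poly λ A → Σ Poly λ B → Σ Poly λ Q → Σ Poly λ X → Σ Poly λ Y →
    HasDegree A 1 × HasDegree B 2 × HasDegree Q 2 × HasDegree X 8 × HasDegree Y 11 ×
    IsZeroPoly ((((X *P (X *P X)) +P (A *P X)) +P B) +P (-P (Q *P (Y *P Y)))) ×
    ¬ IsZeroPoly ((constP (int 4 ·L 1L) *P (A *P (A *P A))) +P (constP (int 27 ·L 1L) *P (B *P B)))
mainTheorem3 =
  A₀ , B₀ , Q₀ , X₀ , Y₀ ,
  HasDegree-by-evaluation A₀ 1 refl ,
  HasDegree-by-evaluation B₀ 2 refl ,
  HasDegree-by-evaluation Q₀ 2 refl ,
  HasDegree-by-evaluation X₀ 8 refl ,
  HasDegree-by-evaluation Y₀ 11 refl ,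
  IsZeroPoly-by-evaluation (weierstrassResidual A₀ B₀ Q₀ X₀ Y₀) ,
  discriminant≢0
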